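{- Let $p_1,q_1,p_2,q_2$ be non-negative integers with $p_1>0$, $q_2>0$ and $p_1q_2-q_1p_2>0$, and let $\mathcal{M}\subseteq\mathcal{B}'$. If there is a move $(A,B)\to(A-s,B-t)$ in the subtraction game $G(\mathcal{M})$, then for each $(x,y)\in\mathcal{T}_Q$ there is a move in the $Q$-subtraction game $G_Q(\mathcal{M})$ of the form $$(x+Ap_1+Bp_2,\ y+Aq_1+Bq_2)\to(x+(A-s)p_1+(B-t)p_2,\ y+(A-s)q_1+(B-t)q_2).$$ Conversely, if there is a move in $G_Q(\mathcal{M})$ from $(X,Y)\in\mathcal{B}_Q$ via $(s,t)\in\mathcal{M}$, then there is a corresponding move $(A,B)\to(A-s,B-t)$ in $G(\mathcal{M})$, where $(X,Y)=(x+Ap_1+Bp_2,\ y+Aq_1+Bq_2)$ for some $(x,y)\in\mathcal{T}_Q$.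
   Context: Let $\mathcal{B}$ be the set of ordered pairs of non-negative integers and $\mathcal{B}'=\mathcal{B}\setminus\{(0,0)\}$. Let $\mathcal{B}_Q=\{(X,Y)\in\mathcal{B}\mid Xq_1\le Yp_1 \text{ and } Yp_2\le Xq_2\}$. The subtraction game $G(\mathcal{M})$ has positions $\mathcal{B}$, with a move from $(A,B)$ to $(A-s,B-t)$ for any $(s,t)\in\mathcal{M}$ with $(A-s,B-t)\in\mathcal{B}$. The $Q$-subtraction game $G_Q(\mathcal{M})$ has positions $\mathcal{B}_Q$, with a move from $(X,Y)$ to $(X-p_1s-p_2t,\ Y-q_1s-q_2t)$ for any $(s,t)\in\mathcal{M}$ such that this pair lies in $\mathcal{B}_Q$ (a "move via $(s,t)$"). Let $\mathcal{T}_Q=\{(x,y)\in\mathcal{B}_Q\mid p_1(y-q_2)<q_1(x-p_2)\text{ and } p_2(y-q_1)>q_2(x-p_1)\}$. -}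

module Defs where

open import Data.Nat using (ℕ; _+_; _*_; _∸_; _≤_)
open import Data.Integer as ℤ using (ℤ; +_)
open import Data.Product using (_×_; _,_)
open import Relation.Binary.PropositionalEquality using (_≡_)
open import Relation.Nullary using (¬_)

-- A set of moves M ⊆ ℕ × ℕ is a predicate; M ⊆ B' means (0,0) ∉ M.
SubsetB' : (ℕ → ℕ → Set) → Set
SubsetB' M = ∀ s t → M s t → ¬ (s ≡ 0 × t ≡ 0)

Move : (ℕ → ℕ → Set) → ℕ → ℕ → ℕ → ℕ → Set
Move M A B s t = M s t × s ≤ A × t ≤ B

module _ (p₁ q₁ p₂ q₂ : ℕ) where

  InBQ : ℕ → ℕ → Set
  InBQ X Y = X * q₁ ≤ Y * p₁ × Y * p₂ ≤ X * q₂

  InTQ : ℕ → ℕ → Set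
  InTQ x y = InBQ x y
    × (+ p₁ ℤ.* (+ y ℤ.- + q₂) ℤ.< + q₁ ℤ.* (+ x ℤ.- + p₂))
    × (+ p₂ ℤ.* (+ y ℤ.- + q₁) ℤ.> + q₂ ℤ.* (+ x ℤ.- + p₁))

  -- the pair (X - p₁s - p₂t, Y - q₁s - q₂t) (meaningful when the subtractions are non-negative)
  QTargetX : ℕ → ℕ → ℕ → ℕ
  QTargetX X s t = X ∸ (p₁ * s + p₂ * t)

  QTargetY : ℕ → ℕ → ℕ → ℕ
  QTargetY Y s t = Y ∸ (q₁ * s + q₂ * t)

  QMove : (ℕ → ℕ → Set) → ℕ → ℕ → ℕ → ℕ → Set
  QMove M X Y s t =
    M s t × InBQ X Y
    × p₁ * s + p₂ * t ≤ X × q₁ * s + q₂ * t ≤ Y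
    × InBQ (QTargetX X s t) (QTargetY Y s t)

-- With d = p₁q₂ − q₁p₂ > 0, Cramer's rule writes d·(X, Y) = u·(p₁, q₁) + v·(p₂, q₂)
-- where u = Xq₂ − Yp₂ and v = Yp₁ − Xq₁. So B_Q is the cone u, v ≥ 0, T_Q is the
-- half-open fundamental parallelogram 0 ≤ u, v < d of the lattice spanned by
-- (p₁, q₁) and (p₂, q₂), and translating by A(p₁, q₁) + B(p₂, q₂) adds (Ad, Bd) to
-- (u, v). Hence every point of B_Q is (x, y) + A(p₁, q₁) + B(p₂, q₂) with (x, y) in
-- T_Q, A = ⌊u/d⌋ and B = ⌊v/d⌋, and a move via (s, t) stays in B_Q exactly when it
-- does not take (u, v) below 0, i.e. when s ≤ A and t ≤ B.

module Submission where

open import Defs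
open import Data.Nat using (ℕ; _+_; _*_; _∸_; _<_; _≤_; NonZero; >-nonZero)
open import Data.Nat.Properties
open import Data.Nat.DivMod using (_/_; _%_; m≡m%n+[m/n]*n; m%n<n; m/n*n≤m; m*n/n≡m; /-monoˡ-≤)
open import Data.Nat.Tactic.RingSolver using (solve; solve-∀)
open import Data.Integer as ℤ using (+_)
import Data.Integer.Properties as ℤP
open import Algebra.Properties.Ring ℤP.+-*-ring using (x[y-z]≈xy-xz)
open import Data.List using (_∷_; [])
open import Data.Product using (_×_; _,_; ∃-syntax)
open import Function.Bundles using (_⇔_; mk⇔; Equivalence)
open import Relation.Binary.PropositionalEquality
  using (_≡_; refl; sym; trans; cong; cong₂; subst; subst₂; module ≡-Reasoning)

translate-split : ∀ x A B s t a b → s ≤ A → t ≤ B →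
  x + A * a + B * b ≡ (x + (A ∸ s) * a + (B ∸ t) * b) + (a * s + b * t)
translate-split x A B s t a b s≤A t≤B = begin
  x + A * a + B * b
    ≡⟨ cong₂ (λ A B → x + A * a + B * b) (sym (m+[n∸m]≡n s≤A)) (sym (m+[n∸m]≡n t≤B)) ⟩
  x + (s + (A ∸ s)) * a + (t + (B ∸ t)) * b
    ≡⟨ regroup x s (A ∸ s) t (B ∸ t) a b ⟩
  (x + (A ∸ s) * a + (B ∸ t) * b) + (a * s + b * t) ∎
  where
  open ≡-Reasoning
  regroup : ∀ x s A′ t B′ a b →
    x + (s + A′) * a + (t + B′) * b ≡ (x + A′ * a + B′ * b) + (a * s + b * t)
  regroup = solve-∀

translate-∸ : ∀ x A B s t a b → s ≤ A → t ≤ B →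
  (x + A * a + B * b) ∸ (a * s + b * t) ≡ x + (A ∸ s) * a + (B ∸ t) * b
translate-∸ x A B s t a b s≤A t≤B =
  trans (cong (_∸ (a * s + b * t)) (translate-split x A B s t a b s≤A t≤B))
        (m+n∸n≡m _ (a * s + b * t))

translate-≥ : ∀ x A B s t a b → s ≤ A → t ≤ B → a * s + b * t ≤ x + A * a + B * b
translate-≥ x A B s t a b s≤A t≤B =
  subst (a * s + b * t ≤_) (sym (translate-split x A B s t a b s≤A t≤B))
    (m≤n+m (a * s + b * t) (x + (A ∸ s) * a + (B ∸ t) * b))

+-<-slack : ∀ {c m n d e f} → c + m ≡ n → m < d → e + d ≡ f → n + e < c + f
+-<-slack {c} {m} {n} {d} {e} {f} c+m≡n m<d e+d≡f = begin-strict
  n + e       ≡⟨ cong (_+ e) c+m≡n ⟨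
  c + m + e   ≡⟨ +-assoc c m e ⟩
  c + (m + e) <⟨ +-monoʳ-< c (+-monoˡ-< e m<d) ⟩
  c + (d + e) ≡⟨ cong (λ k → c + k) (trans (+-comm d e) e+d≡f) ⟩
  c + f       ∎
  where open ≤-Reasoning

[+m]-[+n]<[+o]-[+p] : ∀ m n o p → m + p < o + n → + m ℤ.- + n ℤ.< + o ℤ.- + p
[+m]-[+n]<[+o]-[+p] m n o p lt = begin-strict
  + m ℤ.- + n           ≡⟨ ℤP.[+m]-[+n]≡m⊖n m n ⟩
  m ℤ.⊖ n               ≡⟨ ℤP.+-cancelˡ-⊖ p m n ⟨
  (p + m) ℤ.⊖ (p + n)   <⟨ ℤP.⊖-monoˡ-< (p + n) (subst₂ _<_ (+-comm m p) (+-comm o n) lt) ⟩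
  (n + o) ℤ.⊖ (p + n)   ≡⟨ cong ((n + o) ℤ.⊖_) (+-comm p n) ⟩
  (n + o) ℤ.⊖ (n + p)   ≡⟨ ℤP.+-cancelˡ-⊖ n o p ⟩
  o ℤ.⊖ p               ≡⟨ ℤP.[+m]-[+n]≡m⊖n o p ⟨
  + o ℤ.- + p           ∎
  where open ℤP.≤-Reasoning

+[a]*[m-n]<+[b]*[o-p] : ∀ a m n b o p → m * a + p * b < o * b + n * a →
  + a ℤ.* (+ m ℤ.- + n) ℤ.< + b ℤ.* (+ o ℤ.- + p)
+[a]*[m-n]<+[b]*[o-p] a m n b o p lt = begin-strict
  + a ℤ.* (+ m ℤ.- + n)         ≡⟨ x[y-z]≈xy-xz (+ a) (+ m) (+ n) ⟩
  + a ℤ.* + m ℤ.- + a ℤ.* + n   ≡⟨ cong₂ ℤ._-_ (pos-*-comm a m) (pos-*-comm a n) ⟩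
  + (m * a) ℤ.- + (n * a)       <⟨ [+m]-[+n]<[+o]-[+p] (m * a) (n * a) (o * b) (p * b) lt ⟩
  + (o * b) ℤ.- + (p * b)       ≡⟨ cong₂ ℤ._-_ (pos-*-comm b o) (pos-*-comm b p) ⟨
  + b ℤ.* + o ℤ.- + b ℤ.* + p   ≡⟨ x[y-z]≈xy-xz (+ b) (+ o) (+ p) ⟨
  + b ℤ.* (+ o ℤ.- + p)         ∎
  where
  open ℤP.≤-Reasoning
  pos-*-comm : ∀ k l → + k ℤ.* + l ≡ + (l * k)
  pos-*-comm k l = trans (sym (ℤP.pos-* k l)) (cong +_ (*-comm k l))

0<[+m]-[+n]⇒n<m : ∀ m n → + 0 ℤ.< + m ℤ.- + n → n < m
0<[+m]-[+n]⇒n<m m n 0<m-n = ≰⇒> (λ m≤n → ℤP.<⇒≱ 0<m-n (ℤP.i≤j⇒i-j≤0 (ℤ.+≤+ m≤n)))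

combination-≤ : ∀ A B {d Z u v a b} .{{_ : NonZero d}} →
  d * Z ≡ u * a + v * b → A * d ≤ u → B * d ≤ v → A * a + B * b ≤ Z
combination-≤ A B {d} {Z} {u} {v} {a} {b} dZ≡ Ad≤u Bd≤v = *-cancelˡ-≤ d (begin
  d * (A * a + B * b)   ≡⟨ solve (d ∷ A ∷ B ∷ a ∷ b ∷ []) ⟩
  A * d * a + B * d * b ≤⟨ +-mono-≤ (*-monoˡ-≤ a Ad≤u) (*-monoˡ-≤ b Bd≤v) ⟩
  u * a + v * b         ≡⟨ dZ≡ ⟨
  d * Z                 ∎)
  where open ≤-Reasoning

m*n≤o⇒m≤o/n : ∀ m n o .{{_ : NonZero n}} → m * n ≤ o → m ≤ o / n
m*n≤o⇒m≤o/n m n o mn≤o = subst (_≤ o / n) (m*n/n≡m m n) (/-monoˡ-≤ n mn≤o)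

∸-split : ∀ Z P Q → P + Q ≤ Z → Z ≡ (Z ∸ (P + Q)) + P + Q
∸-split Z P Q le = sym (trans (+-assoc (Z ∸ (P + Q)) P Q) (m∸n+n≡m le))

∸-split-comm : ∀ Z s t a b → a * s + b * t ≤ Z → Z ≡ (Z ∸ (a * s + b * t)) + s * a + t * b
∸-split-comm Z s t a b le = trans (∸-split Z (a * s) (b * t) le)
  (cong₂ (λ P Q → Z ∸ (a * s + b * t) + P + Q) (*-comm a s) (*-comm b t))

module Coordinates (p₁ q₁ p₂ q₂ d : ℕ) (det : q₁ * p₂ + d ≡ p₁ * q₂) where

  open Equivalence using (to; from)

  private variable X Y x y u u′ v v′ : ℕ

  record Coord₁ (X Y u : ℕ) : Set where
    constructor coord₁
    field balance : Y * p₂ + u ≡ X * q₂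

  record Coord₂ (X Y v : ℕ) : Set where
    constructor coord₂
    field balance : X * q₁ + v ≡ Y * p₁

  Coord₁-unique : Coord₁ X Y u → Coord₁ X Y u′ → u ≡ u′
  Coord₁-unique {Y = Y} (coord₁ h) (coord₁ h′) = +-cancelˡ-≡ (Y * p₂) _ _ (trans h (sym h′))

  Coord₂-unique : Coord₂ X Y v → Coord₂ X Y v′ → v ≡ v′
  Coord₂-unique {X = X} (coord₂ h) (coord₂ h′) = +-cancelˡ-≡ (X * q₁) _ _ (trans h (sym h′))

  Coord₁-translate : ∀ A B →
    Coord₁ x y u ⇔ Coord₁ (x + A * p₁ + B * p₂) (y + A * q₁ + B * q₂) (u + A * d)
  Coord₁-translate {x} {y} {u} A B = mk⇔
    (λ (coord₁ h) → coord₁ (trans shiftedʸ (trans (cong (_+ K) h) (sym shiftedˣ))))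
    (λ (coord₁ h) → coord₁ (+-cancelʳ-≡ K _ _ (trans (sym shiftedʸ) (trans h shiftedˣ))))
    where
    open ≡-Reasoning
    K : ℕ
    K = A * (p₁ * q₂) + B * (q₂ * p₂)
    shiftedʸ : (y + A * q₁ + B * q₂) * p₂ + (u + A * d) ≡ (y * p₂ + u) + K
    shiftedʸ = begin
      (y + A * q₁ + B * q₂) * p₂ + (u + A * d)
        ≡⟨ solve (y ∷ A ∷ B ∷ u ∷ p₁ ∷ q₁ ∷ p₂ ∷ q₂ ∷ d ∷ []) ⟩
      (y * p₂ + u) + (A * (q₁ * p₂ + d) + B * (q₂ * p₂))
        ≡⟨ cong (λ e → (y * p₂ + u) + (A * e + B * (q₂ * p₂))) det ⟩
      (y * p₂ + u) + K ∎
    shiftedˣ : (x + A * p₁ + B * p₂) * q₂ ≡ x * q₂ + (A * (p₁ * q₂) + B * (q₂ * p₂))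
    shiftedˣ = solve (x ∷ A ∷ B ∷ p₁ ∷ q₁ ∷ p₂ ∷ q₂ ∷ [])

  Coord₂-translate : ∀ A B →
    Coord₂ x y v ⇔ Coord₂ (x + A * p₁ + B * p₂) (y + A * q₁ + B * q₂) (v + B * d)
  Coord₂-translate {x} {y} {v} A B = mk⇔
    (λ (coord₂ h) → coord₂ (trans shiftedˣ (trans (cong (_+ K) h) (sym shiftedʸ))))
    (λ (coord₂ h) → coord₂ (+-cancelʳ-≡ K _ _ (trans (sym shiftedˣ) (trans h shiftedʸ))))
    where
    open ≡-Reasoning
    K : ℕ
    K = A * (p₁ * q₁) + B * (p₁ * q₂)
    shiftedˣ : (x + A * p₁ + B * p₂) * q₁ + (v + B * d) ≡ (x * q₁ + v) + K
    shiftedˣ = begin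
      (x + A * p₁ + B * p₂) * q₁ + (v + B * d)
        ≡⟨ solve (x ∷ A ∷ B ∷ v ∷ p₁ ∷ q₁ ∷ p₂ ∷ q₂ ∷ d ∷ []) ⟩
      (x * q₁ + v) + (A * (p₁ * q₁) + B * (q₁ * p₂ + d))
        ≡⟨ cong (λ e → (x * q₁ + v) + (A * (p₁ * q₁) + B * e)) det ⟩
      (x * q₁ + v) + K ∎
    shiftedʸ : (y + A * q₁ + B * q₂) * p₁ ≡ y * p₁ + (A * (p₁ * q₁) + B * (p₁ * q₂))
    shiftedʸ = solve (y ∷ A ∷ B ∷ p₁ ∷ q₁ ∷ p₂ ∷ q₂ ∷ [])

  cramerˣ : Coord₁ X Y u → Coord₂ X Y v → d * X ≡ u * p₁ + v * p₂
  cramerˣ {X} {Y} {u} {v} (coord₁ hu) (coord₂ hv) =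
    +-cancelˡ-≡ (Y * p₂ * p₁ + X * q₁ * p₂) _ _ (begin
      (Y * p₂ * p₁ + X * q₁ * p₂) + d * X   ≡⟨ solve (X ∷ Y ∷ p₁ ∷ q₁ ∷ p₂ ∷ d ∷ []) ⟩
      Y * p₂ * p₁ + X * (q₁ * p₂ + d)       ≡⟨ cong (λ e → Y * p₂ * p₁ + X * e) det ⟩
      Y * p₂ * p₁ + X * (p₁ * q₂)           ≡⟨ solve (X ∷ Y ∷ p₁ ∷ p₂ ∷ q₂ ∷ []) ⟩
      X * q₂ * p₁ + Y * p₁ * p₂             ≡⟨ cong₂ (λ a b → a * p₁ + b * p₂) hu hv ⟨
      (Y * p₂ + u) * p₁ + (X * q₁ + v) * p₂ ≡⟨ solve (X ∷ Y ∷ u ∷ v ∷ p₁ ∷ q₁ ∷ p₂ ∷ []) ⟩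
      (Y * p₂ * p₁ + X * q₁ * p₂) + (u * p₁ + v * p₂) ∎)
    where open ≡-Reasoning

  cramerʸ : Coord₁ X Y u → Coord₂ X Y v → d * Y ≡ u * q₁ + v * q₂
  cramerʸ {X} {Y} {u} {v} (coord₁ hu) (coord₂ hv) =
    +-cancelˡ-≡ (Y * p₂ * q₁ + X * q₁ * q₂) _ _ (begin
      (Y * p₂ * q₁ + X * q₁ * q₂) + d * Y   ≡⟨ solve (X ∷ Y ∷ q₁ ∷ p₂ ∷ q₂ ∷ d ∷ []) ⟩
      X * q₁ * q₂ + Y * (q₁ * p₂ + d)       ≡⟨ cong (λ e → X * q₁ * q₂ + Y * e) det ⟩
      X * q₁ * q₂ + Y * (p₁ * q₂)           ≡⟨ solve (X ∷ Y ∷ p₁ ∷ q₁ ∷ q₂ ∷ []) ⟩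
      X * q₂ * q₁ + Y * p₁ * q₂             ≡⟨ cong₂ (λ a b → a * q₁ + b * q₂) hu hv ⟨
      (Y * p₂ + u) * q₁ + (X * q₁ + v) * q₂ ≡⟨ solve (X ∷ Y ∷ u ∷ v ∷ q₁ ∷ p₂ ∷ q₂ ∷ []) ⟩
      (Y * p₂ * q₁ + X * q₁ * q₂) + (u * q₁ + v * q₂) ∎)
    where open ≡-Reasoning

  InBQ⇒Coord₁ : ∀ X Y → InBQ p₁ q₁ p₂ q₂ X Y → Coord₁ X Y (X * q₂ ∸ Y * p₂)
  InBQ⇒Coord₁ _ _ (_ , Yp₂≤Xq₂) = coord₁ (m+[n∸m]≡n Yp₂≤Xq₂)

  InBQ⇒Coord₂ : ∀ X Y → InBQ p₁ q₁ p₂ q₂ X Y → Coord₂ X Y (Y * p₁ ∸ X * q₁)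
  InBQ⇒Coord₂ _ _ (Xq₁≤Yp₁ , _) = coord₂ (m+[n∸m]≡n Xq₁≤Yp₁)

  Coord⇒InBQ : Coord₁ X Y u → Coord₂ X Y v → InBQ p₁ q₁ p₂ q₂ X Y
  Coord⇒InBQ {X} {Y} {u} {v} (coord₁ hu) (coord₂ hv) =
    subst (X * q₁ ≤_) hv (m≤m+n (X * q₁) v) , subst (Y * p₂ ≤_) hu (m≤m+n (Y * p₂) u)

  Coord⇒InTQ : Coord₁ x y u → Coord₂ x y v → u < d → v < d → InTQ p₁ q₁ p₂ q₂ x y
  Coord⇒InTQ {x} {y} hu hv u<d v<d =
    Coord⇒InBQ hu hv
    , +[a]*[m-n]<+[b]*[o-p] p₁ y q₂ q₁ x p₂ (+-<-slack (Coord₂.balance hv) v<d det′)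
    , +[a]*[m-n]<+[b]*[o-p] q₂ x p₁ p₂ y q₁ (+-<-slack (Coord₁.balance hu) u<d det)
    where
    det′ : p₂ * q₁ + d ≡ q₂ * p₁
    det′ = trans (cong (_+ d) (*-comm p₂ q₁)) (trans det (*-comm p₁ q₂))

  InBQ-translate : ∀ x y A B → InBQ p₁ q₁ p₂ q₂ x y →
    InBQ p₁ q₁ p₂ q₂ (x + A * p₁ + B * p₂) (y + A * q₁ + B * q₂)
  InBQ-translate x y A B xy∈B = Coord⇒InBQ
    (to (Coord₁-translate {x} {y} A B) (InBQ⇒Coord₁ x y xy∈B))
    (to (Coord₂-translate {x} {y} A B) (InBQ⇒Coord₂ x y xy∈B))

  module _ .{{_ : NonZero d}} where

    coeff₁ coeff₂ : ℕ → ℕ → ℕ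
    coeff₁ X Y = (X * q₂ ∸ Y * p₂) / d
    coeff₂ X Y = (Y * p₁ ∸ X * q₁) / d

    offsetˣ offsetʸ : ℕ → ℕ → ℕ
    offsetˣ X Y = X ∸ (coeff₁ X Y * p₁ + coeff₂ X Y * p₂)
    offsetʸ X Y = Y ∸ (coeff₁ X Y * q₁ + coeff₂ X Y * q₂)

    offsetˣ-decomposition : ∀ X Y → InBQ p₁ q₁ p₂ q₂ X Y →
      X ≡ offsetˣ X Y + coeff₁ X Y * p₁ + coeff₂ X Y * p₂
    offsetˣ-decomposition X Y XY∈B =
      ∸-split X (coeff₁ X Y * p₁) (coeff₂ X Y * p₂) (combination-≤ (coeff₁ X Y) (coeff₂ X Y)
        (cramerˣ (InBQ⇒Coord₁ X Y XY∈B) (InBQ⇒Coord₂ X Y XY∈B))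
        (m/n*n≤m (X * q₂ ∸ Y * p₂) d) (m/n*n≤m (Y * p₁ ∸ X * q₁) d))

    offsetʸ-decomposition : ∀ X Y → InBQ p₁ q₁ p₂ q₂ X Y →
      Y ≡ offsetʸ X Y + coeff₁ X Y * q₁ + coeff₂ X Y * q₂
    offsetʸ-decomposition X Y XY∈B =
      ∸-split Y (coeff₁ X Y * q₁) (coeff₂ X Y * q₂) (combination-≤ (coeff₁ X Y) (coeff₂ X Y)
        (cramerʸ (InBQ⇒Coord₁ X Y XY∈B) (InBQ⇒Coord₂ X Y XY∈B))
        (m/n*n≤m (X * q₂ ∸ Y * p₂) d) (m/n*n≤m (Y * p₁ ∸ X * q₁) d))

    offset-InTQ : ∀ X Y → InBQ p₁ q₁ p₂ q₂ X Y → InTQ p₁ q₁ p₂ q₂ (offsetˣ X Y) (offsetʸ X Y)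
    offset-InTQ X Y XY∈B = Coord⇒InTQ
      (from (Coord₁-translate {x₀} {y₀} A B) (decomposed Coord₁ (InBQ⇒Coord₁ X Y XY∈B)))
      (from (Coord₂-translate {x₀} {y₀} A B) (decomposed Coord₂ (InBQ⇒Coord₂ X Y XY∈B)))
      (m%n<n u₀ d) (m%n<n v₀ d)
      where
      x₀ y₀ A B u₀ v₀ : ℕ
      x₀ = offsetˣ X Y
      y₀ = offsetʸ X Y
      A = coeff₁ X Y
      B = coeff₂ X Y
      u₀ = X * q₂ ∸ Y * p₂
      v₀ = Y * p₁ ∸ X * q₁
      decomposed : ∀ (C : ℕ → ℕ → ℕ → Set) {w} → C X Y w →
        C (x₀ + A * p₁ + B * p₂) (y₀ + A * q₁ + B * q₂) (w % d + w / d * d)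
      decomposed C {w} h =
        subst₂ (λ X′ Y′ → C X′ Y′ (w % d + w / d * d))
          (offsetˣ-decomposition X Y XY∈B) (offsetʸ-decomposition X Y XY∈B)
          (subst (C X Y) (m≡m%n+[m/n]*n w d) h)

    coeff₁-≥ : ∀ {X Y} X′ Y′ s t → InBQ p₁ q₁ p₂ q₂ X′ Y′ →
      X ≡ X′ + s * p₁ + t * p₂ → Y ≡ Y′ + s * q₁ + t * q₂ → s ≤ coeff₁ X Y
    coeff₁-≥ {X} {Y} X′ Y′ s t X′Y′∈B refl refl = m*n≤o⇒m≤o/n s d _ (begin
      s * d                     ≤⟨ m≤n+m (s * d) _ ⟩
      X′ * q₂ ∸ Y′ * p₂ + s * d ≡⟨ Coord₁-unique
        (to (Coord₁-translate s t) (InBQ⇒Coord₁ X′ Y′ X′Y′∈B))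
        (InBQ⇒Coord₁ X Y (InBQ-translate X′ Y′ s t X′Y′∈B)) ⟩
      X * q₂ ∸ Y * p₂ ∎)
      where open ≤-Reasoning

    coeff₂-≥ : ∀ {X Y} X′ Y′ s t → InBQ p₁ q₁ p₂ q₂ X′ Y′ →
      X ≡ X′ + s * p₁ + t * p₂ → Y ≡ Y′ + s * q₁ + t * q₂ → t ≤ coeff₂ X Y
    coeff₂-≥ {X} {Y} X′ Y′ s t X′Y′∈B refl refl = m*n≤o⇒m≤o/n t d _ (begin
      t * d                     ≤⟨ m≤n+m (t * d) _ ⟩
      Y′ * p₁ ∸ X′ * q₁ + t * d ≡⟨ Coord₂-unique
        (to (Coord₂-translate s t) (InBQ⇒Coord₂ X′ Y′ X′Y′∈B))
        (InBQ⇒Coord₂ X Y (InBQ-translate X′ Y′ s t X′Y′∈B)) ⟩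
      Y * p₁ ∸ X * q₁ ∎)
      where open ≤-Reasoning

    QMove⇒Move : (M : ℕ → ℕ → Set) (X Y s t : ℕ)
      → InBQ p₁ q₁ p₂ q₂ X Y → QMove p₁ q₁ p₂ q₂ M X Y s t
      → ∃[ A ] ∃[ B ] ∃[ x ] ∃[ y ]
          (InTQ p₁ q₁ p₂ q₂ x y
          × X ≡ x + A * p₁ + B * p₂ × Y ≡ y + A * q₁ + B * q₂
          × Move M A B s t
          × QTargetX p₁ q₁ p₂ q₂ X s t ≡ x + (A ∸ s) * p₁ + (B ∸ t) * p₂
          × QTargetY p₁ q₁ p₂ q₂ Y s t ≡ y + (A ∸ s) * q₁ + (B ∸ t) * q₂)
    QMove⇒Move M X Y s t XY∈B (m , _ , le₁ , le₂ , target∈B) =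
      A , B , x₀ , y₀ , offset-InTQ X Y XY∈B , eX , eY , (m , s≤A , t≤B)
      , trans (cong (_∸ (p₁ * s + p₂ * t)) eX) (translate-∸ x₀ A B s t p₁ p₂ s≤A t≤B)
      , trans (cong (_∸ (q₁ * s + q₂ * t)) eY) (translate-∸ y₀ A B s t q₁ q₂ s≤A t≤B)
      where
      A B x₀ y₀ X′ Y′ : ℕ
      A = coeff₁ X Y
      B = coeff₂ X Y
      x₀ = offsetˣ X Y
      y₀ = offsetʸ X Y
      X′ = X ∸ (p₁ * s + p₂ * t)
      Y′ = Y ∸ (q₁ * s + q₂ * t)
      eX : X ≡ x₀ + A * p₁ + B * p₂
      eX = offsetˣ-decomposition X Y XY∈B
      eY : Y ≡ y₀ + A * q₁ + B * q₂
      eY = offsetʸ-decomposition X Y XY∈B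
      eX′ : X ≡ X′ + s * p₁ + t * p₂
      eX′ = ∸-split-comm X s t p₁ p₂ le₁
      eY′ : Y ≡ Y′ + s * q₁ + t * q₂
      eY′ = ∸-split-comm Y s t q₁ q₂ le₂
      s≤A : s ≤ A
      s≤A = coeff₁-≥ X′ Y′ s t target∈B eX′ eY′
      t≤B : t ≤ B
      t≤B = coeff₂-≥ X′ Y′ s t target∈B eX′ eY′

  Move⇒QMove : (M : ℕ → ℕ → Set) (A B s t : ℕ) → Move M A B s t
    → (x y : ℕ) → InTQ p₁ q₁ p₂ q₂ x y
    → QMove p₁ q₁ p₂ q₂ M (x + A * p₁ + B * p₂) (y + A * q₁ + B * q₂) s t
      × QTargetX p₁ q₁ p₂ q₂ (x + A * p₁ + B * p₂) s t ≡ x + (A ∸ s) * p₁ + (B ∸ t) * p₂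
      × QTargetY p₁ q₁ p₂ q₂ (y + A * q₁ + B * q₂) s t ≡ y + (A ∸ s) * q₁ + (B ∸ t) * q₂
  Move⇒QMove M A B s t (m , s≤A , t≤B) x y (xy∈B , _) =
    ( m , InBQ-translate x y A B xy∈B
    , translate-≥ x A B s t p₁ p₂ s≤A t≤B , translate-≥ y A B s t q₁ q₂ s≤A t≤B
    , subst₂ (InBQ p₁ q₁ p₂ q₂) (sym targetˣ) (sym targetʸ)
        (InBQ-translate x y (A ∸ s) (B ∸ t) xy∈B))
    , targetˣ , targetʸ
    where
    targetˣ : (x + A * p₁ + B * p₂) ∸ (p₁ * s + p₂ * t) ≡ x + (A ∸ s) * p₁ + (B ∸ t) * p₂
    targetˣ = translate-∸ x A B s t p₁ p₂ s≤A t≤B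
    targetʸ : (y + A * q₁ + B * q₂) ∸ (q₁ * s + q₂ * t) ≡ y + (A ∸ s) * q₁ + (B ∸ t) * q₂
    targetʸ = translate-∸ y A B s t q₁ q₂ s≤A t≤B

lemma4 : (p₁ q₁ p₂ q₂ : ℕ) → 0 < p₁ → 0 < q₂
    → (+ 0) ℤ.< (+ p₁ ℤ.* + q₂) ℤ.- (+ q₁ ℤ.* + p₂)
    → (M : ℕ → ℕ → Set) → SubsetB' M
    → ((A B s t : ℕ) → Move M A B s t
        → (x y : ℕ) → InTQ p₁ q₁ p₂ q₂ x y
        → QMove p₁ q₁ p₂ q₂ M (x + A * p₁ + B * p₂) (y + A * q₁ + B * q₂) s t
          × QTargetX p₁ q₁ p₂ q₂ (x + A * p₁ + B * p₂) s t ≡ x + (A ∸ s) * p₁ + (B ∸ t) * p₂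
          × QTargetY p₁ q₁ p₂ q₂ (y + A * q₁ + B * q₂) s t ≡ y + (A ∸ s) * q₁ + (B ∸ t) * q₂)
      × ((X Y s t : ℕ) → InBQ p₁ q₁ p₂ q₂ X Y → QMove p₁ q₁ p₂ q₂ M X Y s t
        → ∃[ A ] ∃[ B ] ∃[ x ] ∃[ y ]
            (InTQ p₁ q₁ p₂ q₂ x y
            × X ≡ x + A * p₁ + B * p₂ × Y ≡ y + A * q₁ + B * q₂
            × Move M A B s t
            × QTargetX p₁ q₁ p₂ q₂ X s t ≡ x + (A ∸ s) * p₁ + (B ∸ t) * p₂
            × QTargetY p₁ q₁ p₂ q₂ Y s t ≡ y + (A ∸ s) * q₁ + (B ∸ t) * q₂))
lemma4 p₁ q₁ p₂ q₂ _ _ det>0 M _ = Move⇒QMove M , QMove⇒Move M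
  where
  q₁p₂<p₁q₂ : q₁ * p₂ < p₁ * q₂
  q₁p₂<p₁q₂ = 0<[+m]-[+n]⇒n<m (p₁ * q₂) (q₁ * p₂)
    (subst₂ (λ i j → + 0 ℤ.< i ℤ.- j) (sym (ℤP.pos-* p₁ q₂)) (sym (ℤP.pos-* q₁ p₂)) det>0)
  d : ℕ
  d = p₁ * q₂ ∸ q₁ * p₂
  instance
    d≢0 : NonZero d
    d≢0 = >-nonZero (m<n⇒0<n∸m q₁p₂<p₁q₂)
  open Coordinates p₁ q₁ p₂ q₂ d (m+[n∸m]≡n (<⇒≤ q₁p₂<p₁q₂))
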